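{- If $G$ and $H$ are graphs having no isolated vertices, then $\iota(G\,\Box\, H)\le \beta(G)\beta(H)$. Moreover, the bound is sharp (there exist such graphs attaining equality).
   Context: All graphs are finite and simple; $\Box$ is the Cartesian product; $\beta$ is the vertex cover number. A set $A$ of vertices is isolating if no two vertices outside the closed neighborhood $N[A]$ are adjacent; $\iota$ is the minimum size of an isolating set. -}

module Defs where

open import Data.Nat using (ℕ; _≤_)
open import Data.Product using (Σ; ∃; ∃-syntax; _×_; _,_; proj₁; proj₂)
open import Data.Sum using (_⊎_)
open import Data.Empty using (⊥)
open import Data.List using (List; length; cartesianProduct)
open import Data.List.Membership.Propositional using (_∈_; _∉_)
open import Data.List.Membership.Propositional.Properties using (∈-cartesianProduct⁺)
open import Data.List.Relation.Unary.Unique.Propositional using (Unique)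
open import Data.List.Relation.Unary.Unique.Propositional.Properties using (cartesianProduct⁺)
open import Relation.Nullary using (¬_)
open import Relation.Binary.PropositionalEquality using (_≡_)

-- A finite simple graph: a vertex type with a duplicate-free complete
-- enumeration, and a symmetric irreflexive adjacency relation.
record Graph : Set₁ where
  field
    V        : Set
    verts    : List V
    unique   : Unique verts
    complete : (v : V) → v ∈ verts
    Adj      : V → V → Set
    sym      : ∀ {u v} → Adj u v → Adj v u
    irrefl   : ∀ {v} → ¬ Adj v v

open Graph public

record VSet (G : Graph) : Set where
  constructor vset
  field
    elems  : List (V G)
    nodup  : Unique elems

open VSet public

size : {G : Graph} → VSet G → ℕ
size A = length (elems A)

_∈ˢ_ : {G : Graph} → V G → VSet G → Set
v ∈ˢ A = v ∈ elems A

NoIsolated : Graph → Set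
NoIsolated G = (v : V G) → ∃[ u ] Adj G v u

InClosedNbhd : (G : Graph) → VSet G → V G → Set
InClosedNbhd G A v = ∃[ a ] (a ∈ˢ A × (v ≡ a ⊎ Adj G a v))

IsIsolating : (G : Graph) → VSet G → Set
IsIsolating G A = ∀ u v → ¬ InClosedNbhd G A u → ¬ InClosedNbhd G A v → ¬ Adj G u v

IsVertexCover : (G : Graph) → VSet G → Set
IsVertexCover G C = ∀ u v → Adj G u v → u ∈ˢ C ⊎ v ∈ˢ C

IsolationNumber : Graph → ℕ → Set
IsolationNumber G k =
  (∃[ A ] (IsIsolating G A × size A ≡ k)) ×
  (∀ A → IsIsolating G A → k ≤ size A)

VertexCoverNumber : Graph → ℕ → Set
VertexCoverNumber G k =
  (∃[ C ] (IsVertexCover G C × size C ≡ k)) ×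
  (∀ C → IsVertexCover G C → k ≤ size C)

open import Relation.Binary.PropositionalEquality using (refl)
open import Data.Sum using (inj₁; inj₂)

□Adj : (G H : Graph) → V G × V H → V G × V H → Set
□Adj G H (g , h) (g' , h') = (g ≡ g' × Adj H h h') ⊎ (Adj G g g' × h ≡ h')

□sym : (G H : Graph) → ∀ {u v} → □Adj G H u v → □Adj G H v u
□sym G H {g , h} {g' , h'} (inj₁ (refl , a)) = inj₁ (refl , Graph.sym H a)
□sym G H {g , h} {g' , h'} (inj₂ (a , refl)) = inj₂ (Graph.sym G a , refl)

□irr : (G H : Graph) → ∀ {v} → ¬ □Adj G H v v
□irr G H {g , h} (inj₁ (_ , a)) = Graph.irrefl H a
□irr G H {g , h} (inj₂ (a , _)) = Graph.irrefl G a

_□_ : Graph → Graph → Graph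
G □ H = record
  { V        = V G × V H
  ; verts    = cartesianProduct (verts G) (verts H)
  ; unique   = cartesianProduct⁺ (unique G) (unique H)
  ; complete = λ { (g , h) → ∈-cartesianProduct⁺ (complete G g) (complete H h) }
  ; Adj      = □Adj G H
  ; sym      = □sym G H
  ; irrefl   = □irr G H
  }

module Submission where

open import Defs
open import Data.Nat using (ℕ; _≤_; _*_; _+_; s≤s; z≤n)
open import Data.Nat.Properties using (≤-trans; ≤-reflexive)
open import Data.Product using (∃-syntax; _×_; _,_)
open import Data.Sum using (inj₁; inj₂)
open import Data.Bool using (Bool; true; false)
open import Data.Empty using (⊥-elim)
open import Data.List using (List; []; _∷_; length; cartesianProduct; map)
open import Data.List.Properties using (length-++; length-map)
open import Data.List.Relation.Unary.Any using (here; there)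
open import Data.List.Relation.Unary.AllPairs using ([]; _∷_)
open import Data.List.Relation.Unary.All using ([]; _∷_)
open import Data.List.Membership.Propositional.Properties using (∈-cartesianProduct⁺)
open import Data.List.Relation.Unary.Unique.Propositional.Properties using (cartesianProduct⁺)
open import Relation.Nullary using (¬_)
open import Relation.Binary.PropositionalEquality
  using (_≡_; _≢_; refl; cong₂; trans)
  renaming (sym to ≡-sym)

-- A vertex cover of a graph without isolated vertices is dominating, so
-- A = C_G × C_H dominates every row {g} × H with g ∈ C_G and every column
-- G × {h} with h ∈ C_H.  An edge (g,h)(g,h′) of G □ H comes from an edge hh′
-- of H, so h or h′ lies in C_H and that endpoint lies in a dominated column;
-- symmetrically for edges (g,h)(g′,h).  Hence A is isolating and
-- ι(G □ H) ≤ |A| = β(G) β(H).  Equality holds for K₂ □ K₂ = C₄, where a single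
-- vertex is isolating.

length-cartesianProduct : {A B : Set} (xs : List A) (ys : List B) →
  length (cartesianProduct xs ys) ≡ length xs * length ys
length-cartesianProduct []       ys = refl
length-cartesianProduct (x ∷ xs) ys =
  trans (length-++ (map (x ,_) ys))
        (cong₂ _+_ (length-map (x ,_) ys) (length-cartesianProduct xs ys))

IsDominating : (G : Graph) → VSet G → Set
IsDominating G D = ∀ v → InClosedNbhd G D v

vertexCover⇒dominating : (G : Graph) → NoIsolated G →
  (C : VSet G) → IsVertexCover G C → IsDominating G C
vertexCover⇒dominating G noIso C cover v with noIso v
... | u , v~u with cover v u v~u
...   | inj₁ v∈C = v , v∈C , inj₁ refl
...   | inj₂ u∈C = u , u∈C , inj₂ (Graph.sym G v~u)

_⊠_ : {G H : Graph} → VSet G → VSet H → VSet (G □ H)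
A ⊠ B = vset (cartesianProduct (elems A) (elems B))
             (cartesianProduct⁺ (nodup A) (nodup B))

size-⊠ : {G H : Graph} (A : VSet G) (B : VSet H) → size (A ⊠ B) ≡ size A * size B
size-⊠ A B = length-cartesianProduct (elems A) (elems B)

module _ (G H : Graph) where

  ⊠-dominates-column : (D : VSet G) (B : VSet H) {g : V G} {h : V H} →
    InClosedNbhd G D g → h ∈ˢ B → InClosedNbhd (G □ H) (D ⊠ B) (g , h)
  ⊠-dominates-column D B (d , d∈D , inj₁ refl) h∈B =
    (d , _) , ∈-cartesianProduct⁺ d∈D h∈B , inj₁ refl
  ⊠-dominates-column D B (d , d∈D , inj₂ d~g) h∈B =
    (d , _) , ∈-cartesianProduct⁺ d∈D h∈B , inj₂ (inj₂ (d~g , refl))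

  ⊠-dominates-row : (A : VSet G) (D : VSet H) {g : V G} {h : V H} →
    g ∈ˢ A → InClosedNbhd H D h → InClosedNbhd (G □ H) (A ⊠ D) (g , h)
  ⊠-dominates-row A D g∈A (d , d∈D , inj₁ refl) =
    (_ , d) , ∈-cartesianProduct⁺ g∈A d∈D , inj₁ refl
  ⊠-dominates-row A D g∈A (d , d∈D , inj₂ d~h) =
    (_ , d) , ∈-cartesianProduct⁺ g∈A d∈D , inj₂ (inj₁ (refl , d~h))

  ⊠-dominatingCovers-isolating :
    (C : VSet G) → IsVertexCover G C → IsDominating G C →
    (D : VSet H) → IsVertexCover H D → IsDominating H D →
    IsIsolating (G □ H) (C ⊠ D)
  ⊠-dominatingCovers-isolating C coverC domC D coverD domD
    (g , h) (g′ , h′) ∉u ∉v (inj₁ (refl , h~h′)) with coverD h h′ h~h′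
  ... | inj₁ h∈D  = ∉u (⊠-dominates-column C D (domC g) h∈D)
  ... | inj₂ h′∈D = ∉v (⊠-dominates-column C D (domC g) h′∈D)
  ⊠-dominatingCovers-isolating C coverC domC D coverD domD
    (g , h) (g′ , h′) ∉u ∉v (inj₂ (g~g′ , refl)) with coverC g g′ g~g′
  ... | inj₁ g∈C  = ∉u (⊠-dominates-row C D g∈C (domD h))
  ... | inj₂ g′∈C = ∉v (⊠-dominates-row C D g′∈C (domD h))

isolation-≤-vertexCover-product : (G H : Graph) → NoIsolated G → NoIsolated H →
  (i b₁ b₂ : ℕ) → IsolationNumber (G □ H) i →
  VertexCoverNumber G b₁ → VertexCoverNumber H b₂ → i ≤ b₁ * b₂
isolation-≤-vertexCover-product G H noIsoG noIsoH i b₁ b₂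
  (_ , i-minimal) ((C , coverC , |C|≡b₁) , _) ((D , coverD , |D|≡b₂) , _) =
  ≤-trans (i-minimal (C ⊠ D) isolating)
          (≤-reflexive (trans (size-⊠ C D) (cong₂ _*_ |C|≡b₁ |D|≡b₂)))
  where
  isolating : IsIsolating (G □ H) (C ⊠ D)
  isolating = ⊠-dominatingCovers-isolating G H
    C coverC (vertexCover⇒dominating G noIsoG C coverC)
    D coverD (vertexCover⇒dominating H noIsoH D coverD)

nonempty⇒1≤size : {G : Graph} (A : VSet G) → ¬ elems A ≡ [] → 1 ≤ size A
nonempty⇒1≤size (vset []      _) ≢[] = ⊥-elim (≢[] refl)
nonempty⇒1≤size (vset (_ ∷ _) _) ≢[] = s≤s z≤n

vertexCover-of-edge-nonempty : (G : Graph) {u v : V G} → Adj G u v →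
  (C : VSet G) → IsVertexCover G C → ¬ elems C ≡ []
vertexCover-of-edge-nonempty G {u} {v} u~v (vset [] _) cover refl
  with cover u v u~v
... | inj₁ ()
... | inj₂ ()

isolating-of-edge-nonempty : (G : Graph) {u v : V G} → Adj G u v →
  (A : VSet G) → IsIsolating G A → ¬ elems A ≡ []
isolating-of-edge-nonempty G {u} {v} u~v (vset [] _) isolating refl =
  isolating u v (λ { (_ , () , _) }) (λ { (_ , () , _) }) u~v

K₂ : Graph
K₂ = record
  { V        = Bool
  ; verts    = false ∷ true ∷ []
  ; unique   = ((λ ()) ∷ []) ∷ [] ∷ []
  ; complete = λ { false → here refl ; true → there (here refl) }
  ; Adj      = _≢_
  ; sym      = λ u≢v v≡u → u≢v (≡-sym v≡u)
  ; irrefl   = λ v≢v → v≢v refl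
  }

K₂-noIsolated : NoIsolated K₂
K₂-noIsolated false = true  , λ ()
K₂-noIsolated true  = false , λ ()

K₂-vertexCoverNumber : VertexCoverNumber K₂ 1
K₂-vertexCoverNumber =
  (vset (false ∷ []) ([] ∷ []) , cover , refl) ,
  λ C coverC → nonempty⇒1≤size C
    (vertexCover-of-edge-nonempty K₂ {false} {true} (λ ()) C coverC)
  where
  cover : IsVertexCover K₂ (vset (false ∷ []) ([] ∷ []))
  cover false _     _  = inj₁ (here refl)
  cover true  false _  = inj₂ (here refl)
  cover true  true  t≢t = ⊥-elim (t≢t refl)

corner : VSet (K₂ □ K₂)
corner = vset ((false , false) ∷ []) ([] ∷ [])

outside-corner-nbhd⇒opposite : ∀ u → ¬ InClosedNbhd (K₂ □ K₂) corner u →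
  u ≡ (true , true)
outside-corner-nbhd⇒opposite (false , false) ∉N =
  ⊥-elim (∉N (_ , here refl , inj₁ refl))
outside-corner-nbhd⇒opposite (false , true)  ∉N =
  ⊥-elim (∉N (_ , here refl , inj₂ (inj₁ (refl , λ ()))))
outside-corner-nbhd⇒opposite (true , false)  ∉N =
  ⊥-elim (∉N (_ , here refl , inj₂ (inj₂ ((λ ()) , refl))))
outside-corner-nbhd⇒opposite (true , true)   ∉N = refl

corner-isolating : IsIsolating (K₂ □ K₂) corner
corner-isolating u v ∉u ∉v u~v
  with outside-corner-nbhd⇒opposite u ∉u | outside-corner-nbhd⇒opposite v ∉v
... | refl | refl = Graph.irrefl (K₂ □ K₂) u~v

K₂□K₂-isolationNumber : IsolationNumber (K₂ □ K₂) 1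
K₂□K₂-isolationNumber =
  (corner , corner-isolating , refl) ,
  λ A isolating → nonempty⇒1≤size A
    (isolating-of-edge-nonempty (K₂ □ K₂) {false , false} {false , true}
      (inj₁ (refl , λ ())) A isolating)

theorem3p5 : ((G H : Graph) → NoIsolated G → NoIsolated H →
    (i b₁ b₂ : ℕ) → IsolationNumber (G □ H) i →
    VertexCoverNumber G b₁ → VertexCoverNumber H b₂ → i ≤ b₁ * b₂)
    ×
    (∃[ G ] ∃[ H ] V G × V H ×
    NoIsolated G × NoIsolated H ×
    ∃[ i ] ∃[ b₁ ] ∃[ b₂ ] (IsolationNumber (G □ H) i ×
    VertexCoverNumber G b₁ × VertexCoverNumber H b₂ × i ≡ b₁ * b₂))
theorem3p5 =
  isolation-≤-vertexCover-product ,
  ( K₂ , K₂ , false , false , K₂-noIsolated , K₂-noIsolated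
  , 1 , 1 , 1
  , K₂□K₂-isolationNumber , K₂-vertexCoverNumber , K₂-vertexCoverNumber , refl )
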